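{- Let $\mathcal{P}$ be a set of pairwise edge-disjoint paths in $\mathrm{LIC}$, no two of which cross at any vertex other than $a,b,c,d,u_5,u_6$, such that for some $S''\in\{\{s'_1,s'_2\},\{s'_3,s'_4\}\}$, $\mathcal{P}$ contains exactly two $(\{s_1,s_2\},S'')$-paths, and $\mathcal{P}$ contains exactly two $(T,T')$-paths. Then $S''=\{s'_3,s'_4\}$. Moreover, $\mathcal{P}$ contains no $(S\cup T,S'\cup T')$-path other than these four paths.
   Context: $\mathrm{LIC}$ is the plane graph drawn with straight edges on the vertices (with coordinates) $t_1(4,22)$, $t_2(4,10)$, $t'_1(24,22)$, $t'_2(24,10)$, $s_1(6,24)$, $s_2(10,24)$, $s_3(18,24)$, $s_4(22,24)$, $s'_1(6,8)$, $s'_2(10,8)$, $s'_3(18,8)$, $s'_4(22,8)$, $u_1(6,22)$, $u_2(10,22)$, $u_3(18,22)$, $u_4(22,22)$, $u_5(10,18)$, $u_6(18,18)$, $u_7(10,14)$, $u_8(18,14)$, $u_9(6,10)$, $u_{10}(10,10)$, $u_{11}(18,10)$, $u_{12}(22,10)$, $a(14,18)$, $b(12,16)$, $c(16,16)$, $d(14,14)$, with edges $s_1u_1, t_1u_1, u_1u_2, u_1u_5, s_2u_2, u_2u_5, u_2a, s_3u_3, u_3u_4, u_3u_6, u_3a, s_4u_4, t'_1u_4, u_4u_6, u_5u_7, u_5b, u_6u_8, u_6c, u_7u_9, u_7u_{10}, u_7b, u_8u_{11}, u_8u_{12}, u_8c, t_2u_9, s'_1u_9, u_9u_{10}, s'_2u_{10},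 u_{10}d, s'_3u_{11}, u_{11}u_{12}, u_{11}d, t'_2u_{12}, s'_4u_{12}, ab, ac, bd, cd$. Let $S=\{s_1,\dots,s_4\}$, $S'=\{s'_1,\dots,s'_4\}$, $T=\{t_1,t_2\}$, $T'=\{t'_1,t'_2\}$; an $(X,Y)$-path is a path with one extremity in $X$ and the other in $Y$. A path is a sequence of distinct consecutive edges. Two edge-disjoint paths $P_1,P_2$ cross at a vertex $v$ if there are four edges $e_1,\dots,e_4$ incident to $v$, in this cyclic order around $v$ in the drawing, with $e_1,e_3$ consecutive in $P_1$ and $e_2,e_4$ consecutive in $P_2$. In $\mathrm{LIC}$ the crossing vertices are exactly $a,b,c,d,u_5,u_6$: paths are not allowed to cross at any other vertex. -}

module Defs where

open import Data.Nat using (ℕ)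
open import Data.Integer using (ℤ; +_; _-_; _*_; _<_)
open import Data.Product using (_×_; _,_; Σ; ∃-syntax)
open import Data.Sum using (_⊎_)
open import Data.Empty using (⊥)
open import Data.Unit using (⊤)
open import Data.List using (List; []; _∷_)
open import Data.List.Membership.Propositional using (_∈_)
open import Data.List.Relation.Unary.AllPairs using (AllPairs)
open import Data.Fin using (Fin)
open import Relation.Nullary using (¬_)
open import Relation.Binary.PropositionalEquality using (_≡_)

data V : Set where
  t1 t2 t1' t2' : V
  s1 s2 s3 s4 s1' s2' s3' s4' : V
  u1 u2 u3 u4 u5 u6 u7 u8 u9 u10 u11 u12 : V
  a b c d : V

coord : V → ℤ × ℤ
coord t1  = + 4  , + 22
coord t2  = + 4  , + 10
coord t1' = + 24 , + 22
coord t2' = + 24 , + 10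
coord s1  = + 6  , + 24
coord s2  = + 10 , + 24
coord s3  = + 18 , + 24
coord s4  = + 22 , + 24
coord s1' = + 6  , + 8
coord s2' = + 10 , + 8
coord s3' = + 18 , + 8
coord s4' = + 22 , + 8
coord u1  = + 6  , + 22
coord u2  = + 10 , + 22
coord u3  = + 18 , + 22
coord u4  = + 22 , + 22
coord u5  = + 10 , + 18
coord u6  = + 18 , + 18
coord u7  = + 10 , + 14
coord u8  = + 18 , + 14
coord u9  = + 6  , + 10
coord u10 = + 10 , + 10
coord u11 = + 18 , + 10
coord u12 = + 22 , + 10
coord a   = + 14 , + 18
coord b   = + 12 , + 16
coord c   = + 16 , + 16
coord d   = + 14 , + 14

edgeList : List (V × V)
edgeList =
  (s1 , u1) ∷ (t1 , u1) ∷ (u1 , u2) ∷ (u1 , u5) ∷ (s2 , u2) ∷ (u2 , u5) ∷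
  (u2 , a) ∷ (s3 , u3) ∷ (u3 , u4) ∷ (u3 , u6) ∷ (u3 , a) ∷ (s4 , u4) ∷
  (t1' , u4) ∷ (u4 , u6) ∷ (u5 , u7) ∷ (u5 , b) ∷ (u6 , u8) ∷ (u6 , c) ∷
  (u7 , u9) ∷ (u7 , u10) ∷ (u7 , b) ∷ (u8 , u11) ∷ (u8 , u12) ∷ (u8 , c) ∷
  (t2 , u9) ∷ (s1' , u9) ∷ (u9 , u10) ∷ (s2' , u10) ∷ (u10 , d) ∷
  (s3' , u11) ∷ (u11 , u12) ∷ (u11 , d) ∷ (t2' , u12) ∷ (s4' , u12) ∷
  (a , b) ∷ (a , c) ∷ (b , d) ∷ (c , d) ∷ []

Adj : V → V → Set
Adj u v = (u , v) ∈ edgeList ⊎ (v , u) ∈ edgeList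

SameEdge : V × V → V × V → Set
SameEdge (u , v) (x , y) = (u ≡ x × v ≡ y) ⊎ (u ≡ y × v ≡ x)

steps : V → List V → List (V × V)
steps x []       = []
steps x (y ∷ ys) = (x , y) ∷ steps y ys

lastOf : V → List V → V
lastOf x []       = x
lastOf x (y ∷ ys) = lastOf y ys

triples : V → V → List V → List (V × V × V)
triples x y []       = []
triples x y (z ∷ zs) = (x , y , z) ∷ triples y z zs

ConsecutiveAdj : V → List V → Set
ConsecutiveAdj x []       = ⊤
ConsecutiveAdj x (y ∷ ys) = Adj x y × ConsecutiveAdj y ys

record Path : Set where
  field
    first : V
    next  : V
    rest  : List V
    adjacent : ConsecutiveAdj first (next ∷ rest)
    distinctEdges : AllPairs (λ e f → ¬ SameEdge e f) (steps first (next ∷ rest))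

open Path public

edges : Path → List (V × V)
edges p = steps (first p) (next p ∷ rest p)

endA : Path → V
endA p = first p

endB : Path → V
endB p = lastOf (next p) (rest p)

IsPath : (V → Set) → (V → Set) → Path → Set
IsPath X Y p = (X (endA p) × Y (endB p)) ⊎ (Y (endA p) × X (endB p))

EdgeDisjoint : Path → Path → Set
EdgeDisjoint p q = ∀ {e f} → e ∈ edges p → f ∈ edges q → ¬ SameEdge e f

Through : Path → V → V → V → Set
Through p x v y =
  (x , v , y) ∈ triples (first p) (next p) (rest p) ⊎
  (y , v , x) ∈ triples (first p) (next p) (rest p)

-- Cyclic order of edges around a vertex, computed from the drawing.

dir : V → V → ℤ × ℤ
dir v w with coord v | coord w
... | (xv , yv) | (xw , yw) = (xw - xv) , (yw - yv)

-- direction in the half-open upper half plane, angle in [0, π)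
Upper : ℤ × ℤ → Set
Upper (x , y) = (+ 0 < y) ⊎ (y ≡ + 0 × + 0 < x)

crossZ : ℤ × ℤ → ℤ × ℤ → ℤ
crossZ (px , py) (qx , qy) = px * qy - py * qx

-- strictly smaller counterclockwise angle in [0, 2π)
AngLt : ℤ × ℤ → ℤ × ℤ → Set
AngLt p q =
  (Upper p × ¬ Upper q) ⊎
  (Upper p × Upper q × + 0 < crossZ p q) ⊎
  (¬ Upper p × ¬ Upper q × + 0 < crossZ p q)

Inc4 : ℤ × ℤ → ℤ × ℤ → ℤ × ℤ → ℤ × ℤ → Set
Inc4 p q r s = AngLt p q × AngLt q r × AngLt r s

Cyclic4 : ℤ × ℤ → ℤ × ℤ → ℤ × ℤ → ℤ × ℤ → Set
Cyclic4 p q r s = Inc4 p q r s ⊎ Inc4 q r s p ⊎ Inc4 r s p q ⊎ Inc4 s p q r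

Cross : Path → Path → V → Set
Cross p q v = ∃[ w1 ] ∃[ w2 ] ∃[ w3 ] ∃[ w4 ]
  (Adj v w1 × Adj v w2 × Adj v w3 × Adj v w4 ×
   Cyclic4 (dir v w1) (dir v w2) (dir v w3) (dir v w4) ×
   Through p w1 v w3 × Through q w2 v w4)

CrossingVertex : V → Set
CrossingVertex a  = ⊤
CrossingVertex b  = ⊤
CrossingVertex c  = ⊤
CrossingVertex d  = ⊤
CrossingVertex u5 = ⊤
CrossingVertex u6 = ⊤
CrossingVertex _  = ⊥

InS : V → Set
InS s1 = ⊤
InS s2 = ⊤
InS s3 = ⊤
InS s4 = ⊤
InS _  = ⊥

InS' : V → Set
InS' s1' = ⊤
InS' s2' = ⊤
InS' s3' = ⊤
InS' s4' = ⊤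
InS' _   = ⊥

InT : V → Set
InT t1 = ⊤
InT t2 = ⊤
InT _  = ⊥

InT' : V → Set
InT' t1' = ⊤
InT' t2' = ⊤
InT' _   = ⊥

InS12 : V → Set
InS12 s1 = ⊤
InS12 s2 = ⊤
InS12 _  = ⊥

data Side : Set where
  left right : Side

InS'' : Side → V → Set
InS'' left  s1' = ⊤
InS'' left  s2' = ⊤
InS'' right s3' = ⊤
InS'' right s4' = ⊤
InS'' _     _   = ⊥

InST : V → Set
InST v = InS v ⊎ InT v

InS'T' : V → Set
InS'T' v = InS' v ⊎ InT' v

ExactlyTwoAt : ∀ {n} → (Fin n → Path) → (Path → Set) → Fin n → Fin n → Set
ExactlyTwoAt {n} P X i j =
  ¬ i ≡ j × X (P i) × X (P j) × (∀ (k : Fin n) → X (P k) → k ≡ i ⊎ k ≡ j)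

-- All terminals of LIC have degree one, and the vertices t1, t2, s1, s2, s'1, s'2, u1, u2,
-- u5, u7, u9, u10 are separated from the rest of the graph by the four edges u2a, u5b, u7b,
-- u10d; so at most four pairwise edge-disjoint paths join the two sides.
--
-- If S'' = {s'1, s'2}, the non-crossing vertices u1 and u2 force the path from s1 to begin
-- s1 u1 u2 u5, the path from t1 to begin t1 u1 u5 and the path from s2 to begin s2 u2 a.  The
-- path from s2 must come back across the cut, so with the two (T,T')-paths it uses all four
-- cut edges and the path from s1 stays on the left; following it together with the path from
-- t2 through u7, u9 and u10 always produces a crossing at one of these non-crossing vertices.
--
-- If S'' = {s'3, s'4}, all four given paths cross the cut.  Any further (S ∪ T, S' ∪ T')-path
-- either crosses it as well, or starts at one of s1, s2, t1, t2, or ends at one of s'3, s'4,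
-- t'1, t'2, and then shares that terminal's only edge with one of the four paths.
module Submission where

open import Defs
open import Data.Bool using (Bool; true; false; not; T; _∧_; _∨_)
open import Data.Bool.ListAction using (any)
open import Data.Bool.Properties using (not-¬; T-∧; T-∨) renaming (_≟_ to _≟ᵇ_)
open import Data.Empty using (⊥; ⊥-elim)
open import Data.Fin using (Fin; zero; suc; _<_)
import Data.Fin.Properties as Fin
import Data.Integer as ℤ
import Data.Integer.Properties as ℤ
open import Data.List using (List; []; _∷_; map; filter; reverse; _ʳ++_; length; lookup)
open import Data.List.Membership.Propositional using (_∈_; find)
open import Data.List.Membership.Propositional.Properties using (∈-map⁻; ∈-filter⁺; ∈-lookup)
open import Data.List.Relation.Unary.All as All using (All; []; _∷_)
open import Data.List.Relation.Unary.AllPairs as AllPairs using (AllPairs; []; _∷_)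
import Data.List.Relation.Unary.AllPairs.Properties as AllPairs
open import Data.List.Relation.Unary.Any as Any using (Any; here; there)
open import Data.List.Relation.Unary.Any.Properties using (reverse⁻; lookup-index; any⁺)
open import Data.Nat using (ℕ; _≤_; s≤s)
open import Data.Product using (_×_; _,_; proj₁; proj₂; ∃-syntax; swap)
open import Data.Product.Properties using (≡-dec)
open import Data.Sum using (_⊎_; inj₁; inj₂)
import Data.Sum as Sum
open import Data.Unit using (⊤; tt)
open import Function using (_∘_)
open import Function.Bundles using (module Equivalence)
open Equivalence using (from)
open import Relation.Binary.Definitions using (Symmetric; tri<; tri≈; tri>)
open import Relation.Binary.PropositionalEquality using (_≡_; _≢_; refl; sym; trans; cong; subst)
open import Relation.Nullary using (¬_; Dec; yes; no; ¬?)
open import Relation.Nullary.Decidable using (True; ⌊_⌋; toWitness; fromWitness; _×-dec_; _⊎-dec_)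

pattern #0 = here refl
pattern #1 = there #0
pattern #2 = there #1
pattern #3 = there #2
pattern #4 = there #3
pattern #5 = there #4

pattern parallel     = inj₁ (refl , refl)
pattern antiparallel = inj₂ (refl , refl)

module _ {ℓ r} {A : Set ℓ} {R : A → A → Set r} where

  allPairs-ʳ++ : Symmetric R → ∀ {xs ys} → AllPairs R xs → AllPairs R ys →
    All (λ x → All (R x) ys) xs → AllPairs R (xs ʳ++ ys)
  allPairs-ʳ++ sym [] Rys _ = Rys
  allPairs-ʳ++ sym (Rx ∷ Rxs) Rys (Rxys ∷ Rxsys) =
    allPairs-ʳ++ sym Rxs (Rxys ∷ Rys) (All.zipWith (λ (r , rs) → sym r ∷ rs) (Rx , Rxsys))

  allPairs-reverse : Symmetric R → ∀ {xs} → AllPairs R xs → AllPairs R (reverse xs)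
  allPairs-reverse sym Rxs = allPairs-ʳ++ sym Rxs [] (All.tabulate (λ _ → []))

  allPairs-lookup : ∀ {xs} → AllPairs R xs → ∀ {i j} → i < j → R (lookup xs i) (lookup xs j)
  allPairs-lookup (Rx ∷ _)  {zero}  {suc j} _         = All.lookup Rx (∈-lookup j)
  allPairs-lookup (_ ∷ Rxs) {suc i} {suc j} (s≤s i<j) = allPairs-lookup Rxs i<j

SameEdge-sym : ∀ {e f} → SameEdge e f → SameEdge f e
SameEdge-sym parallel     = parallel
SameEdge-sym antiparallel = antiparallel

SameEdge-trans : ∀ {e f g} → SameEdge e f → SameEdge f g → SameEdge e g
SameEdge-trans parallel     s            = s
SameEdge-trans antiparallel parallel     = antiparallel
SameEdge-trans antiparallel antiparallel = parallel

Different : V × V → V × V → Set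
Different e f = ¬ SameEdge e f

Different-sym : ∀ {e f} → Different e f → Different f e
Different-sym e≁f = e≁f ∘ SameEdge-sym

Different-swap : ∀ {e f} → Different e f → Different (swap e) (swap f)
Different-swap {_ , _} {_ , _} e≁f parallel     = e≁f parallel
Different-swap {_ , _} {_ , _} e≁f antiparallel = e≁f antiparallel

Adj-sym : ∀ {x y} → Adj x y → Adj y x
Adj-sym = Sum.swap

-- Adjacency as a boolean that computes on closed vertices: a case split on a vertex y
-- constrained by T (adjacentᵇ x y) for a concrete x only produces the neighbours of x.
_≈ᵇ_ : V → V → Bool
x ≈ᵇ y = ⌊ ≡-dec ℤ._≟_ ℤ._≟_ (coord x) (coord y) ⌋

≈ᵇ-refl : ∀ {x} → T (x ≈ᵇ x)
≈ᵇ-refl {x} = fromWitness {a? = ≡-dec ℤ._≟_ ℤ._≟_ (coord x) (coord x)} refl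

joinsᵇ : V → V → V × V → Bool
joinsᵇ x y (p , q) = (p ≈ᵇ x ∧ q ≈ᵇ y) ∨ (p ≈ᵇ y ∧ q ≈ᵇ x)

adjacentᵇ : V → V → Bool
adjacentᵇ x y = any (joinsᵇ x y) edgeList

joinsᵇ-itself : ∀ x y → T (joinsᵇ x y (x , y))
joinsᵇ-itself x y = from (T-∨ {x ≈ᵇ x ∧ y ≈ᵇ y}) (inj₁ (from (T-∧ {x ≈ᵇ x}) (≈ᵇ-refl {x} , ≈ᵇ-refl {y})))

joinsᵇ-reversed : ∀ x y → T (joinsᵇ x y (y , x))
joinsᵇ-reversed x y = from (T-∨ {y ≈ᵇ x ∧ x ≈ᵇ y}) (inj₂ (from (T-∧ {y ≈ᵇ y}) (≈ᵇ-refl {y} , ≈ᵇ-refl {x})))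

Adj⇒adjacentᵇ : ∀ {x y} → Adj x y → T (adjacentᵇ x y)
Adj⇒adjacentᵇ {x} {y} (inj₁ m) = any⁺ (joinsᵇ x y) (Any.map (λ { refl → joinsᵇ-itself x y }) m)
Adj⇒adjacentᵇ {x} {y} (inj₂ m) = any⁺ (joinsᵇ x y) (Any.map (λ { refl → joinsᵇ-reversed x y }) m)

Terminal : V → Set
Terminal t1  = ⊤
Terminal t2  = ⊤
Terminal t1' = ⊤
Terminal t2' = ⊤
Terminal s1  = ⊤
Terminal s2  = ⊤
Terminal s3  = ⊤
Terminal s4  = ⊤
Terminal s1' = ⊤
Terminal s2' = ⊤
Terminal s3' = ⊤
Terminal s4' = ⊤
Terminal _   = ⊥

Leaf : V → Set
Leaf v = ∀ {x y} → Adj v x → Adj v y → x ≡ y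

terminal-leaf : ∀ {v} → Terminal v → Leaf v
terminal-leaf terminal vx vy = unique terminal (Adj⇒adjacentᵇ vx) (Adj⇒adjacentᵇ vy)
  where
  unique : ∀ {v x y} → Terminal v → T (adjacentᵇ v x) → T (adjacentᵇ v y) → x ≡ y
  unique {t1}  {u1}  {u1}  _ _ _ = refl
  unique {t2}  {u9}  {u9}  _ _ _ = refl
  unique {t1'} {u4}  {u4}  _ _ _ = refl
  unique {t2'} {u12} {u12} _ _ _ = refl
  unique {s1}  {u1}  {u1}  _ _ _ = refl
  unique {s2}  {u2}  {u2}  _ _ _ = refl
  unique {s3}  {u3}  {u3}  _ _ _ = refl
  unique {s4}  {u4}  {u4}  _ _ _ = refl
  unique {s1'} {u9}  {u9}  _ _ _ = refl
  unique {s2'} {u10} {u10} _ _ _ = refl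
  unique {s3'} {u11} {u11} _ _ _ = refl
  unique {s4'} {u12} {u12} _ _ _ = refl

pairs : List V → List (V × V)
pairs []       = []
pairs (x ∷ xs) = steps x xs

windows : List V → List (V × V × V)
windows []           = []
windows (x ∷ [])     = []
windows (x ∷ y ∷ zs) = triples x y zs

reverse₃ : V × V × V → V × V × V
reverse₃ (x , v , y) = y , v , x

pairs-ʳ++ : ∀ xs y acc → pairs (xs ʳ++ y ∷ acc) ≡ map swap (pairs (y ∷ xs)) ʳ++ pairs (y ∷ acc)
pairs-ʳ++ []       y acc = refl
pairs-ʳ++ (x ∷ xs) y acc = pairs-ʳ++ xs x (y ∷ acc)

windows-ʳ++ : ∀ xs y z acc →
  windows (xs ʳ++ y ∷ z ∷ acc) ≡ map reverse₃ (windows (z ∷ y ∷ xs)) ʳ++ windows (y ∷ z ∷ acc)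
windows-ʳ++ []       y z acc = refl
windows-ʳ++ (x ∷ xs) y z acc = windows-ʳ++ xs x y (z ∷ acc)

pairs-reverse : ∀ xs → pairs (reverse xs) ≡ reverse (map swap (pairs xs))
pairs-reverse []       = refl
pairs-reverse (x ∷ xs) = pairs-ʳ++ xs x []

windows-reverse : ∀ xs → windows (reverse xs) ≡ reverse (map reverse₃ (windows xs))
windows-reverse []           = refl
windows-reverse (x ∷ [])     = refl
windows-reverse (x ∷ y ∷ xs) = windows-ʳ++ xs y x []

∈-pairs-reverse : ∀ xs {x y} → (x , y) ∈ pairs (reverse xs) → (y , x) ∈ pairs xs
∈-pairs-reverse xs m with ∈-map⁻ swap (reverse⁻ (subst ((_ , _) ∈_) (pairs-reverse xs) m))
... | _ , m' , refl = m'

∈-windows-reverse : ∀ xs {x v y} → (x , v , y) ∈ windows (reverse xs) → (y , v , x) ∈ windows xs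
∈-windows-reverse xs m with ∈-map⁻ reverse₃ (reverse⁻ (subst ((_ , _ , _) ∈_) (windows-reverse xs) m))
... | _ , m' , refl = m'

ʳ++-endpoints : ∀ xs y z acc →
  ∃[ w ] ∃[ l ] (xs ʳ++ y ∷ z ∷ acc ≡ lastOf y xs ∷ w ∷ l × lastOf w l ≡ lastOf z acc)
ʳ++-endpoints []       y z acc = z , acc , refl , refl
ʳ++-endpoints (x ∷ xs) y z acc = ʳ++-endpoints xs x y (z ∷ acc)

window-steps : ∀ {l x v y} → (x , v , y) ∈ windows l → (x , v) ∈ pairs l × (v , y) ∈ pairs l
window-steps {_ ∷ _ ∷ _ ∷ _} #0        = #0 , #1
window-steps {_ ∷ _ ∷ _ ∷ _} (there m) = let p , q = window-steps m in there p , there q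

last-step : ∀ x y ys → ∃[ w ] (w , lastOf y ys) ∈ pairs (x ∷ y ∷ ys)
last-step x y []       = x , #0
last-step x y (z ∷ zs) = let w , m = last-step y z zs in w , there m

record Trail (l : List V) : Set where
  field
    linked   : ∀ {x y} → (x , y) ∈ pairs l → Adj x y
    distinct : AllPairs Different (pairs l)

open Trail public

Disjoint : List V → List V → Set
Disjoint l m = ∀ {e f} → e ∈ pairs l → f ∈ pairs m → Different e f

drop-first : ∀ {x xs} → Trail (x ∷ xs) → Trail xs
drop-first {xs = []}    t = record { linked = λ () ; distinct = [] }
drop-first {xs = _ ∷ _} t = record { linked = linked t ∘ there ; distinct = AllPairs.tail (distinct t) }

neighbour : ∀ {l x y} → Trail l → (x , y) ∈ pairs l → T (adjacentᵇ x y)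
neighbour t m = Adj⇒adjacentᵇ (linked t m)

backtrack : ∀ {l x v} → Trail l → (x , v , x) ∈ windows l → ⊥
backtrack {_ ∷ _ ∷ _ ∷ _} t #0 with distinct t
... | (x≁y ∷ _) ∷ _ = x≁y antiparallel
backtrack {_ ∷ _ ∷ _ ∷ _} t (there m) = backtrack (drop-first t) m

turn-adjacent : ∀ {l x v y} → Trail l → (x , v , y) ∈ windows l ⊎ (y , v , x) ∈ windows l →
  Adj v x × Adj v y
turn-adjacent {l} t (inj₁ m) = let p , q = window-steps {l} m in Adj-sym (linked t p) , linked t q
turn-adjacent {l} t (inj₂ m) = let p , q = window-steps {l} m in linked t q , Adj-sym (linked t p)

same-leaf-start : ∀ {v x y l m} → Trail (v ∷ x ∷ l) → Trail (v ∷ y ∷ m) →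
  Disjoint (v ∷ x ∷ l) (v ∷ y ∷ m) → Leaf v → ⊥
same-leaf-start t t' disjoint leaf with leaf (linked t #0) (linked t' #0)
... | refl = disjoint #0 #0 parallel

same-leaf-end : ∀ {v x y l x' y' m} → Trail (x ∷ y ∷ l) → Trail (x' ∷ y' ∷ m) →
  Disjoint (x ∷ y ∷ l) (x' ∷ y' ∷ m) → Leaf v → lastOf y l ≡ v → lastOf y' m ≡ v → ⊥
same-leaf-end {x = x} {y} {l} {x'} {y'} {m} t t' disjoint leaf end end'
  with w , p ← last-step x y l | w' , p' ← last-step x' y' m
  with refl ← leaf (Adj-sym (subst (Adj w) end (linked t p))) (Adj-sym (subst (Adj w') end' (linked t' p')))
  = disjoint p p' (inj₁ (refl , trans end (sym end')))

no-three-trails-to-two-leaves : ∀ {τ τ' x y l x₁ y₁ l₁ x₂ y₂ l₂} → Leaf τ → Leaf τ' →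
  Trail (x ∷ y ∷ l) → Trail (x₁ ∷ y₁ ∷ l₁) → Trail (x₂ ∷ y₂ ∷ l₂) →
  Disjoint (x ∷ y ∷ l) (x₁ ∷ y₁ ∷ l₁) → Disjoint (x ∷ y ∷ l) (x₂ ∷ y₂ ∷ l₂) →
  Disjoint (x₁ ∷ y₁ ∷ l₁) (x₂ ∷ y₂ ∷ l₂) →
  lastOf y l ≡ τ ⊎ lastOf y l ≡ τ' → lastOf y₁ l₁ ≡ τ ⊎ lastOf y₁ l₁ ≡ τ' →
  lastOf y₂ l₂ ≡ τ ⊎ lastOf y₂ l₂ ≡ τ' → ⊥
no-three-trails-to-two-leaves leaf _ t t₁ _ d₀₁ _ _ (inj₁ e) (inj₁ e₁) _ =
  same-leaf-end t t₁ d₀₁ leaf e e₁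
no-three-trails-to-two-leaves leaf _ t _ t₂ _ d₀₂ _ (inj₁ e) (inj₂ _) (inj₁ e₂) =
  same-leaf-end t t₂ d₀₂ leaf e e₂
no-three-trails-to-two-leaves _ leaf' _ t₁ t₂ _ _ d₁₂ (inj₁ _) (inj₂ e₁) (inj₂ e₂) =
  same-leaf-end t₁ t₂ d₁₂ leaf' e₁ e₂
no-three-trails-to-two-leaves _ leaf' t t₁ _ d₀₁ _ _ (inj₂ e) (inj₂ e₁) _ =
  same-leaf-end t t₁ d₀₁ leaf' e e₁
no-three-trails-to-two-leaves _ leaf' t _ t₂ _ d₀₂ _ (inj₂ e) (inj₁ _) (inj₂ e₂) =
  same-leaf-end t t₂ d₀₂ leaf' e e₂
no-three-trails-to-two-leaves leaf _ _ t₁ t₂ _ _ d₁₂ (inj₂ _) (inj₁ e₁) (inj₁ e₂) =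
  same-leaf-end t₁ t₂ d₁₂ leaf e₁ e₂

-- The left side of the cut formed by the edges u2a, u5b, u7b and u10d.
inL : V → Bool
inL t1  = true
inL t2  = true
inL s1  = true
inL s2  = true
inL s1' = true
inL s2' = true
inL u1  = true
inL u2  = true
inL u5  = true
inL u7  = true
inL u9  = true
inL u10 = true
inL _   = false

Across : V × V → Set
Across (x , y) = inL x ≢ inL y

across? : ∀ e → Dec (Across e)
across? (x , y) = ¬? (inL x ≟ᵇ inL y)

cutEdges : List (V × V)
cutEdges = filter across? edgeList

OnCut : V × V → Set
OnCut e = Any (SameEdge e) cutEdges

adj-onCut : ∀ {x y} → Adj x y → Across (x , y) → OnCut (x , y)
adj-onCut (inj₁ m) x≁y = Any.map (λ { refl → parallel }) (∈-filter⁺ across? m x≁y)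
adj-onCut (inj₂ m) x≁y = Any.map (λ { refl → antiparallel }) (∈-filter⁺ across? m (x≁y ∘ sym))

cut-step : ∀ {x xs β} → Trail (x ∷ xs) → inL x ≡ β → inL (lastOf x xs) ≡ not β →
  ∃[ e ] (e ∈ pairs (x ∷ xs) × OnCut e)
cut-step {xs = []} {β} _ x-β x-¬β = ⊥-elim (not-¬ {β} refl (trans (sym x-β) x-¬β))
cut-step {x} {y ∷ _} {β} t x-β end-¬β with inL y ≟ᵇ β
... | yes y-β = let e , m , cut = cut-step (drop-first t) y-β end-¬β in e , there m , cut
... | no y≁β  = (x , y) , #0 , adj-onCut (linked t #0) (λ x~y → y≁β (trans (sym x~y) x-β))

onCut-capacity : ∀ {es} → All OnCut es → AllPairs Different es → length es ≤ length cutEdges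
onCut-capacity {es} cuts different = Fin.injective⇒≤ slot-injective
  where
  slot : Fin (length es) → Fin (length cutEdges)
  slot i = Any.index (All.lookup cuts (∈-lookup i))

  at-slot : ∀ i → SameEdge (lookup es i) (lookup cutEdges (slot i))
  at-slot i = lookup-index (All.lookup cuts (∈-lookup i))

  same-slot : ∀ {i j} → slot i ≡ slot j → SameEdge (lookup es i) (lookup es j)
  same-slot {i} {j} eq = SameEdge-trans (at-slot i)
    (subst (λ e → SameEdge e (lookup es j)) (cong (lookup cutEdges) (sym eq)) (SameEdge-sym (at-slot j)))

  slot-injective : ∀ {i j} → slot i ≡ slot j → i ≡ j
  slot-injective {i} {j} eq with Fin.<-cmp i j
  ... | tri< i<j _ _ = ⊥-elim (allPairs-lookup different i<j (same-slot eq))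
  ... | tri≈ _ i≡j _ = i≡j
  ... | tri> _ _ j<i = ⊥-elim (allPairs-lookup different j<i (same-slot (sym eq)))

no-five-cut-steps : ∀ {e₁ e₂ e₃ e₄ e₅} → All OnCut (e₁ ∷ e₂ ∷ e₃ ∷ e₄ ∷ e₅ ∷ []) →
  AllPairs Different (e₁ ∷ e₂ ∷ e₃ ∷ e₄ ∷ e₅ ∷ []) → ⊥
no-five-cut-steps cuts different with onCut-capacity cuts different
... | s≤s (s≤s (s≤s (s≤s ())))

left-inside : ∀ {v} → InS'' left v → inL v ≡ true
left-inside {s1'} _ = refl
left-inside {s2'} _ = refl

right-outside : ∀ {v} → InS'' right v → inL v ≡ false
right-outside {s3'} _ = refl
right-outside {s4'} _ = refl

T'-outside : ∀ {v} → InT' v → inL v ≡ false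
T'-outside {t1'} _ = refl
T'-outside {t2'} _ = refl

NonCrossing : List V → List V → Set
NonCrossing l m = ∀ {v w₁ w₂ w₃ w₄} →
  (w₁ , v , w₃) ∈ windows l ⊎ (w₃ , v , w₁) ∈ windows l →
  (w₂ , v , w₄) ∈ windows m ⊎ (w₄ , v , w₂) ∈ windows m →
  Cyclic4 (dir v w₁) (dir v w₂) (dir v w₃) (dir v w₄) → CrossingVertex v

upper? : ∀ p → Dec (Upper p)
upper? (x , y) = (ℤ.+ 0 ℤ.<? y) ⊎-dec ((y ℤ.≟ ℤ.+ 0) ×-dec (ℤ.+ 0 ℤ.<? x))

angLt? : ∀ p q → Dec (AngLt p q)
angLt? p q = (upper? p ×-dec ¬? (upper? q))
  ⊎-dec (upper? p ×-dec upper? q ×-dec (ℤ.+ 0 ℤ.<? crossZ p q))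
  ⊎-dec (¬? (upper? p) ×-dec ¬? (upper? q) ×-dec (ℤ.+ 0 ℤ.<? crossZ p q))

inc4? : ∀ p q r s → Dec (Inc4 p q r s)
inc4? p q r s = angLt? p q ×-dec angLt? q r ×-dec angLt? r s

cyclic4? : ∀ p q r s → Dec (Cyclic4 p q r s)
cyclic4? p q r s = inc4? p q r s ⊎-dec inc4? q r s p ⊎-dec inc4? r s p q ⊎-dec inc4? s p q r

crossing : ∀ {l m v w₁ w₂ w₃ w₄} → NonCrossing l m →
  (w₁ , v , w₃) ∈ windows l → (w₂ , v , w₄) ∈ windows m →
  {_ : True (cyclic4? (dir v w₁) (dir v w₂) (dir v w₃) (dir v w₄)
             ⊎-dec cyclic4? (dir v w₁) (dir v w₄) (dir v w₃) (dir v w₂))} →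
  CrossingVertex v
crossing noncrossing p q {order} with toWitness order
... | inj₁ cyclic = noncrossing (inj₁ p) (inj₁ q) cyclic
... | inj₂ cyclic = noncrossing (inj₁ p) (inj₂ q) cyclic

record Linkage (S'' : V → Set) (A B C D : List V) : Set where
  field
    trailA   : Trail (s1 ∷ A)
    trailB   : Trail (s2 ∷ B)
    trailC   : Trail (t1 ∷ C)
    trailD   : Trail (t2 ∷ D)
    arrivesA : S'' (lastOf s1 A)
    arrivesB : S'' (lastOf s2 B)
    arrivesC : InT' (lastOf t1 C)
    arrivesD : InT' (lastOf t2 D)
    disjointAB : Disjoint (s1 ∷ A) (s2 ∷ B)
    disjointAC : Disjoint (s1 ∷ A) (t1 ∷ C)
    disjointAD : Disjoint (s1 ∷ A) (t2 ∷ D)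
    disjointBC : Disjoint (s2 ∷ B) (t1 ∷ C)
    disjointBD : Disjoint (s2 ∷ B) (t2 ∷ D)
    disjointCD : Disjoint (t1 ∷ C) (t2 ∷ D)
    noncrossingAB : NonCrossing (s1 ∷ A) (s2 ∷ B)
    noncrossingAC : NonCrossing (s1 ∷ A) (t1 ∷ C)
    noncrossingAD : NonCrossing (s1 ∷ A) (t2 ∷ D)

open Linkage

s1-path-start : ∀ {A} → Trail (s1 ∷ A) → InS'' left (lastOf s1 A) → ∃[ x ] ∃[ A' ] A ≡ u1 ∷ x ∷ A'
s1-path-start {_ ∷ _} t _ with neighbour t #0
s1-path-start {u1 ∷ x ∷ A} t _ | _ = x , A , refl

s2-path-start : ∀ {B} → Trail (s2 ∷ B) → InS'' left (lastOf s2 B) → ∃[ x ] ∃[ B' ] B ≡ u2 ∷ x ∷ B'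
s2-path-start {_ ∷ _} t _ with neighbour t #0
s2-path-start {u2 ∷ x ∷ B} t _ | _ = x , B , refl

t1-path-start : ∀ {C} → Trail (t1 ∷ C) → InT' (lastOf t1 C) → ∃[ x ] ∃[ C' ] C ≡ u1 ∷ x ∷ C'
t1-path-start {_ ∷ _} t _ with neighbour t #0
t1-path-start {u1 ∷ x ∷ C} t _ | _ = x , C , refl

t2-path-start : ∀ {D} → Trail (t2 ∷ D) → InT' (lastOf t2 D) →
  ∃[ D' ] (D ≡ u9 ∷ u7 ∷ D' ⊎ D ≡ u9 ∷ u10 ∷ D')
t2-path-start {_ ∷ _} t _ with neighbour t #0
t2-path-start {u9 ∷ _ ∷ _} t _ | _ with neighbour t #1
t2-path-start {u9 ∷ u7 ∷ D}  t _ | _ | _ = D , inj₁ refl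
t2-path-start {u9 ∷ u10 ∷ D} t _ | _ | _ = D , inj₂ refl
t2-path-start {u9 ∷ t2 ∷ _}  t _ | _ | _ = ⊥-elim (backtrack t #0)
t2-path-start {u9 ∷ s1' ∷ _ ∷ _} t _ | _ | _ with neighbour t #2
t2-path-start {u9 ∷ s1' ∷ u9 ∷ _} t _ | _ | _ | _ = ⊥-elim (backtrack t #1)

-- The s2-path crosses the cut at u2a and has to cross back; the two T-paths cross it too.
s1-path-avoids-cut : ∀ {A B C D e} → Linkage (InS'' left) (u1 ∷ u2 ∷ u5 ∷ A) (u2 ∷ a ∷ B) C D →
  e ∈ pairs (s1 ∷ u1 ∷ u2 ∷ u5 ∷ A) → OnCut e → ⊥
s1-path-avoids-cut L mA cutA
  with eB , mB , cutB ← cut-step (drop-first (drop-first (trailB L))) refl (left-inside (arrivesB L))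
     | eC , mC , cutC ← cut-step (trailC L) refl (T'-outside (arrivesC L))
     | eD , mD , cutD ← cut-step (trailD L) refl (T'-outside (arrivesD L))
  = no-five-cut-steps (cutA ∷ adj-onCut (linked (trailB L) #1) (λ ()) ∷ cutB ∷ cutC ∷ cutD ∷ [])
      ( (disjointAB L mA #1 ∷ disjointAB L mA mB' ∷ disjointAC L mA mC ∷ disjointAD L mA mD ∷ [])
      ∷ (All.lookup (AllPairs.head (AllPairs.tail (distinct (trailB L)))) mB
         ∷ disjointBC L #1 mC ∷ disjointBD L #1 mD ∷ [])
      ∷ (disjointBC L mB' mC ∷ disjointBD L mB' mD ∷ [])
      ∷ (disjointCD L mC mD ∷ [])
      ∷ [] ∷ [])
  where mB' = there (there mB)

crossing-at-u9 : ∀ {A B C D} → Linkage (InS'' left) (u1 ∷ u2 ∷ u5 ∷ u7 ∷ u9 ∷ A) B C (u9 ∷ u10 ∷ D) → ⊥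
crossing-at-u9 {[]} L = arrivesA L
crossing-at-u9 {_ ∷ _} L with neighbour (trailA L) #5
crossing-at-u9 {u7 ∷ _}  L | _ = backtrack (trailA L) #4
crossing-at-u9 {t2 ∷ _}  L | _ = disjointAD L #5 #0 antiparallel
crossing-at-u9 {u10 ∷ _} L | _ = disjointAD L #5 #1 parallel
crossing-at-u9 {s1' ∷ _} L | _ = crossing (noncrossingAD L) #4 #0

crossing-at-u7 : ∀ {A B C D} → Linkage (InS'' left) (u1 ∷ u2 ∷ u5 ∷ u7 ∷ u10 ∷ A) B C (u9 ∷ u7 ∷ D) → ⊥
crossing-at-u7 {D = []} L = arrivesD L
crossing-at-u7 {D = _ ∷ _} L with neighbour (trailD L) #2
crossing-at-u7 {D = u5 ∷ _}  L | _ = disjointAD L #3 #2 antiparallel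
crossing-at-u7 {D = u9 ∷ _}  L | _ = backtrack (trailD L) #1
crossing-at-u7 {D = u10 ∷ _} L | _ = disjointAD L #4 #2 parallel
crossing-at-u7 {D = b ∷ _}   L | _ = crossing (noncrossingAD L) #3 #1

crossing-at-u10 : ∀ {A B C D} →
  Linkage (InS'' left) (u1 ∷ u2 ∷ u5 ∷ u7 ∷ u10 ∷ A) (u2 ∷ a ∷ B) C (u9 ∷ u10 ∷ D) → ⊥
crossing-at-u10 {[]} L = arrivesA L
crossing-at-u10 {_ ∷ _} {D = []} L = arrivesD L
crossing-at-u10 {_ ∷ _} {D = _ ∷ _} L with neighbour (trailA L) #5 | neighbour (trailD L) #2
crossing-at-u10 {u7 ∷ _} L | _ | _ = backtrack (trailA L) #4
crossing-at-u10 {u9 ∷ _} L | _ | _ = disjointAD L #5 #1 antiparallel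
crossing-at-u10 {d ∷ _}  L | _ | _ = s1-path-avoids-cut L #5 (adj-onCut (linked (trailA L) #5) λ ())
crossing-at-u10 {s2' ∷ _} {D = u7 ∷ _}  L | _ | _ = disjointAD L #4 #2 antiparallel
crossing-at-u10 {s2' ∷ _} {D = u9 ∷ _}  L | _ | _ = backtrack (trailD L) #1
crossing-at-u10 {s2' ∷ _} {D = s2' ∷ _} L | _ | _ = disjointAD L #5 #2 parallel
crossing-at-u10 {s2' ∷ _} {D = d ∷ _}   L | _ | _ = crossing (noncrossingAD L) #4 #1

no-left-linkage-through-u7 : ∀ {A B C D} → Linkage (InS'' left) (u1 ∷ u2 ∷ u5 ∷ u7 ∷ A) (u2 ∷ a ∷ B) C D → ⊥
no-left-linkage-through-u7 {[]} L = arrivesA L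
no-left-linkage-through-u7 {_ ∷ _} L with neighbour (trailA L) #4 | t2-path-start (trailD L) (arrivesD L)
no-left-linkage-through-u7 {u5 ∷ _}  L | _ | _ = backtrack (trailA L) #3
no-left-linkage-through-u7 {b ∷ _}   L | _ | _ = s1-path-avoids-cut L #4 (adj-onCut (linked (trailA L) #4) λ ())
no-left-linkage-through-u7 {u9 ∷ _}  L | _ | _ , inj₁ refl = disjointAD L #4 #1 antiparallel
no-left-linkage-through-u7 {u9 ∷ _}  L | _ | _ , inj₂ refl = crossing-at-u9 L
no-left-linkage-through-u7 {u10 ∷ _} L | _ | _ , inj₁ refl = crossing-at-u7 L
no-left-linkage-through-u7 {u10 ∷ _} L | _ | _ , inj₂ refl = crossing-at-u10 L

no-left-linkage-through-u5 : ∀ {A B C D} →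
  Linkage (InS'' left) (u1 ∷ u2 ∷ u5 ∷ A) (u2 ∷ a ∷ B) (u1 ∷ u5 ∷ C) D → ⊥
no-left-linkage-through-u5 {[]} L = arrivesA L
no-left-linkage-through-u5 {_ ∷ _} L with neighbour (trailA L) #3
no-left-linkage-through-u5 {u1 ∷ _} L | _ = disjointAC L #3 #1 antiparallel
no-left-linkage-through-u5 {u2 ∷ _} L | _ = backtrack (trailA L) #2
no-left-linkage-through-u5 {b ∷ _}  L | _ = s1-path-avoids-cut L #3 (adj-onCut (linked (trailA L) #3) λ ())
no-left-linkage-through-u5 {u7 ∷ _} L | _ = no-left-linkage-through-u7 L

no-left-linkage-through-u2 : ∀ {A B C D} → Linkage (InS'' left) (u1 ∷ u2 ∷ A) B (u1 ∷ u5 ∷ C) D → ⊥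
no-left-linkage-through-u2 {[]} L = arrivesA L
no-left-linkage-through-u2 {_ ∷ _} L with _ , _ , refl ← s2-path-start (trailB L) (arrivesB L)
  with neighbour (trailA L) #2 | neighbour (trailB L) #1
no-left-linkage-through-u2 {u1 ∷ _} L | _ | _ = backtrack (trailA L) #1
no-left-linkage-through-u2 {s2 ∷ _} L | _ | _ = disjointAB L #2 #0 antiparallel
no-left-linkage-through-u2 {_} {u2 ∷ u1 ∷ _} L | _ | _ = disjointAB L #1 #1 antiparallel
no-left-linkage-through-u2 {_} {u2 ∷ s2 ∷ _} L | _ | _ = backtrack (trailB L) #0
no-left-linkage-through-u2 {u5 ∷ _} {u2 ∷ u5 ∷ _} L | _ | _ = disjointAB L #2 #1 parallel
no-left-linkage-through-u2 {a ∷ _}  {u2 ∷ a ∷ _}  L | _ | _ = disjointAB L #2 #1 parallel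
no-left-linkage-through-u2 {a ∷ _}  {u2 ∷ u5 ∷ _} L | _ | _ = crossing (noncrossingAB L) #1 #0
no-left-linkage-through-u2 {u5 ∷ _} {u2 ∷ a ∷ _}  L | _ | _ = no-left-linkage-through-u5 L

no-left-linkage-through-u1 : ∀ {x y A B C D} → Linkage (InS'' left) (u1 ∷ x ∷ A) B (u1 ∷ y ∷ C) D → ⊥
no-left-linkage-through-u1 L with neighbour (trailA L) #1 | neighbour (trailC L) #1
no-left-linkage-through-u1 {s1} L | _ | _ = backtrack (trailA L) #0
no-left-linkage-through-u1 {t1} L | _ | _ = disjointAC L #1 #0 antiparallel
no-left-linkage-through-u1 {_} {s1} L | _ | _ = disjointAC L #0 #1 antiparallel
no-left-linkage-through-u1 {_} {t1} L | _ | _ = backtrack (trailC L) #0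
no-left-linkage-through-u1 {u2} {u2} L | _ | _ = disjointAC L #1 #1 parallel
no-left-linkage-through-u1 {u5} {u5} L | _ | _ = disjointAC L #1 #1 parallel
no-left-linkage-through-u1 {u5} {u2} L | _ | _ = crossing (noncrossingAC L) #0 #0
no-left-linkage-through-u1 {u2} {u5} L | _ | _ = no-left-linkage-through-u2 L

no-left-linkage : ∀ {A B C D} → Linkage (InS'' left) A B C D → ⊥
no-left-linkage L
  with _ , _ , refl ← s1-path-start (trailA L) (arrivesA L)
     | _ , _ , refl ← t1-path-start (trailC L) (arrivesC L)
  = no-left-linkage-through-u1 L

right-cases : ∀ {v} → InS'' right v → v ≡ s3' ⊎ v ≡ s4'
right-cases {s3'} _ = inj₁ refl
right-cases {s4'} _ = inj₂ refl

T'-cases : ∀ {v} → InT' v → v ≡ t1' ⊎ v ≡ t2'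
T'-cases {t1'} _ = inj₁ refl
T'-cases {t2'} _ = inj₂ refl

S'T'-cases : ∀ {v} → InS'T' v → InS'' left v ⊎ InS'' right v ⊎ InT' v
S'T'-cases {s1'} (inj₁ _) = inj₁ tt
S'T'-cases {s2'} (inj₁ _) = inj₁ tt
S'T'-cases {s3'} (inj₁ _) = inj₂ (inj₁ tt)
S'T'-cases {s4'} (inj₁ _) = inj₂ (inj₁ tt)
S'T'-cases {t1'} (inj₂ _) = inj₂ (inj₂ tt)
S'T'-cases {t2'} (inj₂ _) = inj₂ (inj₂ tt)

no-fifth-path-from-the-right : ∀ {x₁ A x₂ B x₃ C x₄ D h y X} →
  Linkage (InS'' right) (x₁ ∷ A) (x₂ ∷ B) (x₃ ∷ C) (x₄ ∷ D) →
  Trail (h ∷ y ∷ X) → inL h ≡ false → InS'T' (lastOf y X) →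
  Disjoint (h ∷ y ∷ X) (s1 ∷ x₁ ∷ A) → Disjoint (h ∷ y ∷ X) (s2 ∷ x₂ ∷ B) →
  Disjoint (h ∷ y ∷ X) (t1 ∷ x₃ ∷ C) → Disjoint (h ∷ y ∷ X) (t2 ∷ x₄ ∷ D) → ⊥
no-fifth-path-from-the-right L tX h-outside end dA dB dC dD with S'T'-cases end
... | inj₁ left-end
  with eX , mX , cutX ← cut-step tX h-outside (left-inside left-end)
     | eA , mA , cutA ← cut-step (trailA L) refl (right-outside (arrivesA L))
     | eB , mB , cutB ← cut-step (trailB L) refl (right-outside (arrivesB L))
     | eC , mC , cutC ← cut-step (trailC L) refl (T'-outside (arrivesC L))
     | eD , mD , cutD ← cut-step (trailD L) refl (T'-outside (arrivesD L))
  = no-five-cut-steps (cutX ∷ cutA ∷ cutB ∷ cutC ∷ cutD ∷ [])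
      ( (dA mX mA ∷ dB mX mB ∷ dC mX mC ∷ dD mX mD ∷ [])
      ∷ (disjointAB L mA mB ∷ disjointAC L mA mC ∷ disjointAD L mA mD ∷ [])
      ∷ (disjointBC L mB mC ∷ disjointBD L mB mD ∷ [])
      ∷ (disjointCD L mC mD ∷ [])
      ∷ [] ∷ [])
... | inj₂ (inj₁ right-end) =
  no-three-trails-to-two-leaves (terminal-leaf {s3'} tt) (terminal-leaf {s4'} tt)
    tX (trailA L) (trailB L) dA dB (disjointAB L)
    (right-cases right-end) (right-cases (arrivesA L)) (right-cases (arrivesB L))
... | inj₂ (inj₂ T'-end) =
  no-three-trails-to-two-leaves (terminal-leaf {t1'} tt) (terminal-leaf {t2'} tt)
    tX (trailC L) (trailD L) dC dD (disjointCD L)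
    (T'-cases T'-end) (T'-cases (arrivesC L)) (T'-cases (arrivesD L))

no-fifth-path : ∀ {A B C D h y X} → Linkage (InS'' right) A B C D →
  Trail (h ∷ y ∷ X) → InST h → InS'T' (lastOf y X) →
  Disjoint (h ∷ y ∷ X) (s1 ∷ A) → Disjoint (h ∷ y ∷ X) (s2 ∷ B) →
  Disjoint (h ∷ y ∷ X) (t1 ∷ C) → Disjoint (h ∷ y ∷ X) (t2 ∷ D) → ⊥
no-fifth-path {A = []} L _ _ _ _ _ _ _ = arrivesA L
no-fifth-path {B = []} L _ _ _ _ _ _ _ = arrivesB L
no-fifth-path {C = []} L _ _ _ _ _ _ _ = arrivesC L
no-fifth-path {D = []} L _ _ _ _ _ _ _ = arrivesD L
no-fifth-path {_ ∷ _} {_ ∷ _} {_ ∷ _} {_ ∷ _} {s1} L tX (inj₁ _) _ dA _ _ _ =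
  same-leaf-start tX (trailA L) dA (terminal-leaf tt)
no-fifth-path {_ ∷ _} {_ ∷ _} {_ ∷ _} {_ ∷ _} {s2} L tX (inj₁ _) _ _ dB _ _ =
  same-leaf-start tX (trailB L) dB (terminal-leaf tt)
no-fifth-path {_ ∷ _} {_ ∷ _} {_ ∷ _} {_ ∷ _} {t1} L tX (inj₂ _) _ _ _ dC _ =
  same-leaf-start tX (trailC L) dC (terminal-leaf tt)
no-fifth-path {_ ∷ _} {_ ∷ _} {_ ∷ _} {_ ∷ _} {t2} L tX (inj₂ _) _ _ _ _ dD =
  same-leaf-start tX (trailD L) dD (terminal-leaf tt)
no-fifth-path {_ ∷ _} {_ ∷ _} {_ ∷ _} {_ ∷ _} {s3} L tX (inj₁ _) end dA dB dC dD =
  no-fifth-path-from-the-right L tX refl end dA dB dC dD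
no-fifth-path {_ ∷ _} {_ ∷ _} {_ ∷ _} {_ ∷ _} {s4} L tX (inj₁ _) end dA dB dC dD =
  no-fifth-path-from-the-right L tX refl end dA dB dC dD

consecutive-adjacent : ∀ {x ys u w} → ConsecutiveAdj x ys → (u , w) ∈ steps x ys → Adj u w
consecutive-adjacent {ys = _ ∷ _} (xy , _)    #0        = xy
consecutive-adjacent {ys = _ ∷ _} (_ , later) (there m) = consecutive-adjacent later m

record Traversal (p : Path) (l : List V) : Set where
  field
    trail : Trail l
    along : ∀ {e} → e ∈ pairs l → Any (SameEdge e) (edges p)
    turns : ∀ {x v y} → (x , v , y) ∈ windows l ⊎ (y , v , x) ∈ windows l → Through p x v y

open Traversal

forward : ∀ p → Traversal p (first p ∷ next p ∷ rest p)
forward p = record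
  { trail = record { linked = consecutive-adjacent (adjacent p) ; distinct = distinctEdges p }
  ; along = Any.map λ { refl → parallel }
  ; turns = λ turn → turn
  }

backward : ∀ p → Traversal p (reverse (first p ∷ next p ∷ rest p))
backward p = record
  { trail = record
    { linked = λ m → Adj-sym (linked (trail (forward p)) (∈-pairs-reverse L m))
    ; distinct = subst (AllPairs Different) (sym (pairs-reverse L))
        (allPairs-reverse Different-sym (AllPairs.map⁺ (AllPairs.map Different-swap (distinctEdges p))))
    }
  ; along = λ { {_ , _} m → Any.map (λ { refl → antiparallel }) (∈-pairs-reverse L m) }
  ; turns = λ { (inj₁ m) → inj₂ (∈-windows-reverse L m) ; (inj₂ m) → inj₁ (∈-windows-reverse L m) }
  }
  where L = first p ∷ next p ∷ rest p

orient : ∀ {X Y : V → Set} p → IsPath X Y p →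
  ∃[ h ] ∃[ y ] ∃[ l ] (Traversal p (h ∷ y ∷ l) × X h × Y (lastOf y l))
orient p (inj₁ (Xh , Yend)) = first p , next p , rest p , forward p , Xh , Yend
orient {Y = Y} p (inj₂ (Yh , Xend))
  with w , l , reversed , ends ← ʳ++-endpoints (rest p) (next p) (first p) []
  = lastOf (next p) (rest p) , w , l , subst (Traversal p) reversed (backward p) , Xend , subst Y (sym ends) Yh

disjoint-traversals : ∀ {p q l m} → EdgeDisjoint p q → Traversal p l → Traversal q m → Disjoint l m
disjoint-traversals p∥q tl tm el fm e~f
  with _ , e'∈p , e~e' ← find (along tl el) | _ , f'∈q , f~f' ← find (along tm fm)
  = p∥q e'∈p f'∈q (SameEdge-trans (SameEdge-sym e~e') (SameEdge-trans e~f f~f'))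

noncrossing-traversals : ∀ {p q l m} → (∀ v → Cross p q v → CrossingVertex v) →
  Traversal p l → Traversal q m → NonCrossing l m
noncrossing-traversals noncrossing tl tm {v} {w₁} {w₂} {w₃} {w₄} turn₁ turn₂ cyclic =
  let vw₁ , vw₃ = turn-adjacent (trail tl) turn₁
      vw₂ , vw₄ = turn-adjacent (trail tm) turn₂
  in noncrossing v (w₁ , w₂ , w₃ , w₄ , vw₁ , vw₂ , vw₃ , vw₄ , cyclic , turns tl turn₁ , turns tm turn₂)

S12-cases : ∀ {v} → InS12 v → v ≡ s1 ⊎ v ≡ s2
S12-cases {s1} _ = inj₁ refl
S12-cases {s2} _ = inj₂ refl

T-cases : ∀ {v} → InT v → v ≡ t1 ⊎ v ≡ t2
T-cases {t1} _ = inj₁ refl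
T-cases {t2} _ = inj₂ refl

S12-not-T-or-T' : ∀ {v} → InS12 v → InT v ⊎ InT' v → ⊥
S12-not-T-or-T' {s1} _ (inj₁ ())
S12-not-T-or-T' {s1} _ (inj₂ ())
S12-not-T-or-T' {s2} _ (inj₁ ())
S12-not-T-or-T' {s2} _ (inj₂ ())

S-and-T-paths-differ : ∀ {side p} → IsPath InS12 (InS'' side) p → IsPath InT InT' p → ⊥
S-and-T-paths-differ (inj₁ (S , _)) (inj₁ (T , _))  = S12-not-T-or-T' S (inj₁ T)
S-and-T-paths-differ (inj₁ (S , _)) (inj₂ (T' , _)) = S12-not-T-or-T' S (inj₂ T')
S-and-T-paths-differ (inj₂ (_ , S)) (inj₁ (_ , T')) = S12-not-T-or-T' S (inj₂ T')
S-and-T-paths-differ (inj₂ (_ , S)) (inj₂ (_ , T))  = S12-not-T-or-T' S (inj₁ T)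

data Reorders {A : Set} (x y : A) : A → A → Set where
  in-order : Reorders x y x y
  swapped  : Reorders x y y x

reorders-≢ : ∀ {A : Set} {x y x' y' : A} → Reorders x y x' y' → x ≢ y → x' ≢ y'
reorders-≢ in-order x≢y = x≢y
reorders-≢ swapped  x≢y = x≢y ∘ sym

reorders-both : ∀ {A : Set} (Q : A → Set) {x y x' y'} → Reorders x y x' y' → Q x → Q y → Q x' × Q y'
reorders-both Q in-order Qx Qy = Qx , Qy
reorders-both Q swapped  Qx Qy = Qy , Qx

module PathFamily (n : ℕ) (P : Fin n → Path)
  (edge-disjoint : ∀ i j → i ≢ j → EdgeDisjoint (P i) (P j))
  (noncrossing : ∀ i j → i ≢ j → ∀ v → Cross (P i) (P j) v → CrossingVertex v) where

  record Route (k : Fin n) (Y : V → Set) (h : V) : Set where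
    field
      second    : V
      onward    : List V
      traversal : Traversal (P k) (h ∷ second ∷ onward)
      arrives   : Y (lastOf second onward)

  open Route

  route : ∀ {X Y : V → Set} {k} → IsPath X Y (P k) → ∃[ h ] (X h × Route k Y h)
  route {X} {Y} {k} path with h , y , l , t , Xh , Yend ← orient {X} {Y} (P k) path
    = h , Xh , record { second = y ; onward = l ; traversal = t ; arrives = Yend }

  avoids : ∀ {k i l Y h} → k ≢ i → Traversal (P k) l → (r : Route i Y h) →
    Disjoint l (h ∷ second r ∷ onward r)
  avoids k≢i t r = disjoint-traversals (edge-disjoint _ _ k≢i) t (traversal r)

  disjoint-routes : ∀ {i j Y Y' h h'} → i ≢ j → (r : Route i Y h) (r' : Route j Y' h') →
    Disjoint (h ∷ second r ∷ onward r) (h' ∷ second r' ∷ onward r')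
  disjoint-routes i≢j r r' = avoids i≢j (traversal r) r'

  noncrossing-routes : ∀ {i j Y Y' h h'} → i ≢ j → (r : Route i Y h) (r' : Route j Y' h') →
    NonCrossing (h ∷ second r ∷ onward r) (h' ∷ second r' ∷ onward r')
  noncrossing-routes i≢j r r' = noncrossing-traversals (noncrossing _ _ i≢j) (traversal r) (traversal r')

  sort : ∀ {X Y : V → Set} {τ τ' i j} → (∀ {v} → X v → v ≡ τ ⊎ v ≡ τ') → Leaf τ → Leaf τ' → i ≢ j →
    IsPath X Y (P i) → IsPath X Y (P j) → ∃[ i' ] ∃[ j' ] (Reorders i j i' j' × Route i' Y τ × Route j' Y τ')
  sort {X} {Y} cases leaf leaf' i≢j Pi Pj
    with h , Xh , r ← route {X} {Y} Pi | h' , Xh' , r' ← route {X} {Y} Pj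
    with cases Xh | cases Xh'
  ... | inj₁ refl | inj₂ refl = _ , _ , in-order , r , r'
  ... | inj₂ refl | inj₁ refl = _ , _ , swapped , r' , r
  ... | inj₁ refl | inj₁ refl =
    ⊥-elim (same-leaf-start (trail (traversal r)) (trail (traversal r')) (disjoint-routes i≢j r r') leaf)
  ... | inj₂ refl | inj₂ refl =
    ⊥-elim (same-leaf-start (trail (traversal r)) (trail (traversal r')) (disjoint-routes i≢j r r') leaf')

  record Configuration (side : Side) (i j i' j' : Fin n) : Set where
    field
      A B C D : List V
      linkage : Linkage (InS'' side) A B C D
      avoided : ∀ {k l} → k ≢ i → k ≢ j → k ≢ i' → k ≢ j' → Traversal (P k) l →
        Disjoint l (s1 ∷ A) × Disjoint l (s2 ∷ B) × Disjoint l (t1 ∷ C) × Disjoint l (t2 ∷ D)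

  configure : ∀ {side i j i' j'} → ExactlyTwoAt P (IsPath InS12 (InS'' side)) i j →
    ExactlyTwoAt P (IsPath InT InT') i' j' → Configuration side i j i' j'
  configure {side} (i≢j , Si , Sj , _) (i'≢j' , Ti , Tj , _)
    with iA , iB , πS , rA , rB ←
           sort {InS12} {InS'' side} S12-cases (terminal-leaf tt) (terminal-leaf tt) i≢j Si Sj
       | iC , iD , πT , rC , rD ←
           sort {InT} {InT'} T-cases (terminal-leaf tt) (terminal-leaf tt) i'≢j' Ti Tj
    = record
      { linkage = record
        { trailA = trail (traversal rA) ; trailB = trail (traversal rB)
        ; trailC = trail (traversal rC) ; trailD = trail (traversal rD)
        ; arrivesA = arrives rA ; arrivesB = arrives rB ; arrivesC = arrives rC ; arrivesD = arrives rD
        ; disjointAB = disjoint-routes (reorders-≢ πS i≢j) rA rB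
        ; disjointAC = disjoint-routes (S≢T SA TC) rA rC
        ; disjointAD = disjoint-routes (S≢T SA TD) rA rD
        ; disjointBC = disjoint-routes (S≢T SB TC) rB rC
        ; disjointBD = disjoint-routes (S≢T SB TD) rB rD
        ; disjointCD = disjoint-routes (reorders-≢ πT i'≢j') rC rD
        ; noncrossingAB = noncrossing-routes (reorders-≢ πS i≢j) rA rB
        ; noncrossingAC = noncrossing-routes (S≢T SA TC) rA rC
        ; noncrossingAD = noncrossing-routes (S≢T SA TD) rA rD
        }
      ; avoided = λ k≢i k≢j k≢i' k≢j' t →
          let k≢iA , k≢iB = reorders-both (_ ≢_) πS k≢i k≢j
              k≢iC , k≢iD = reorders-both (_ ≢_) πT k≢i' k≢j'
          in avoids k≢iA t rA , avoids k≢iB t rB , avoids k≢iC t rC , avoids k≢iD t rD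
      }
    where
    S-path T-path : Fin n → Set
    S-path k = IsPath InS12 (InS'' side) (P k)
    T-path k = IsPath InT InT' (P k)

    SA = proj₁ (reorders-both S-path πS Si Sj)
    SB = proj₂ (reorders-both S-path πS Si Sj)
    TC = proj₁ (reorders-both T-path πT Ti Tj)
    TD = proj₂ (reorders-both T-path πT Ti Tj)

    S≢T : ∀ {k k'} → S-path k → T-path k' → k ≢ k'
    S≢T {k} S T refl = S-and-T-paths-differ {side} {P k} S T

lemma6 : (n : ℕ) (P : Fin n → Path) →
    (∀ i j → ¬ i ≡ j → EdgeDisjoint (P i) (P j)) →
    (∀ i j → ¬ i ≡ j → ∀ v → Cross (P i) (P j) v → CrossingVertex v) →
    (side : Side) (i j i' j' : Fin n) →
    ExactlyTwoAt P (IsPath InS12 (InS'' side)) i j →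
    ExactlyTwoAt P (IsPath InT InT') i' j' →
    side ≡ right ×
    (∀ k → IsPath InST InS'T' (P k) → k ≡ i ⊎ k ≡ j ⊎ k ≡ i' ⊎ k ≡ j')
lemma6 n P edge-disjoint noncrossing left i j i' j' S-paths T-paths =
  ⊥-elim (no-left-linkage (Configuration.linkage (configure S-paths T-paths)))
  where open PathFamily n P edge-disjoint noncrossing
lemma6 n P edge-disjoint noncrossing right i j i' j' S-paths T-paths = refl , only-four
  where
  open PathFamily n P edge-disjoint noncrossing
  open Configuration (configure S-paths T-paths)

  only-four : ∀ k → IsPath InST InS'T' (P k) → k ≡ i ⊎ k ≡ j ⊎ k ≡ i' ⊎ k ≡ j'
  only-four k X-path with k Fin.≟ i | k Fin.≟ j | k Fin.≟ i' | k Fin.≟ j'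
  ... | yes k≡i | _       | _        | _        = inj₁ k≡i
  ... | no _    | yes k≡j | _        | _        = inj₂ (inj₁ k≡j)
  ... | no _    | no _    | yes k≡i' | _        = inj₂ (inj₂ (inj₁ k≡i'))
  ... | no _    | no _    | no _     | yes k≡j' = inj₂ (inj₂ (inj₂ k≡j'))
  ... | no k≢i  | no k≢j  | no k≢i'  | no k≢j'
    with _ , _ , _ , t , starts , ends ← orient {InST} {InS'T'} (P k) X-path
    with dA , dB , dC , dD ← avoided k≢i k≢j k≢i' k≢j' t
    = ⊥-elim (no-fifth-path linkage (trail t) starts ends dA dB dC dD)
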